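{- Let $H = \overline{P_5}$ be the house. Then $rb(K_{4+i},H) \geq 8 + \binom{i}{2}$ for $1 \leq i \leq 4$.
   Context: The house $H$ is the complement of the path $P_5$ on five vertices (a $5$-cycle with one chord). For a graph $F$ and an integer $n$, the rainbow number $rb(K_n,F)$ is the minimum number $m$ such that every edge-colouring of $K_n$ using at least $m$ colours contains a rainbow copy of $F$ (a subgraph isomorphic to $F$ whose edges all have distinct colours). -}

module Defs where

open import Data.Nat using (ℕ; suc; _<_; _<ᵇ_; _≤_; _+_)
open import Data.Nat.Properties using (_≟_)
open import Data.Fin using (Fin; toℕ)
open import Data.Bool using (Bool; true; false; if_then_else_; not)
open import Data.List using (List; []; _∷_; map; concatMap; filterᵇ; allFin; length; deduplicate)
open import Data.List.Relation.Unary.Unique.Propositional using (Unique)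
open import Data.Product using (_×_; _,_; Σ; proj₁; proj₂)
open import Function.Definitions using (Injective)
open import Relation.Binary.PropositionalEquality using (_≡_)

-- An edge-colouring of K_n with colours in ℕ.  The colour of the edge {i,j}
-- (i < j as naturals) is  c i j ; values c i j with i ≥ j are ignored.
Colouring : ℕ → Set
Colouring n = Fin n → Fin n → ℕ

col : ∀ {n} → Colouring n → Fin n → Fin n → ℕ
col c i j = if toℕ i <ᵇ toℕ j then c i j else c j i

edgesK : (n : ℕ) → List (Fin n × Fin n)
edgesK n = concatMap (λ i → map (λ j → (i , j)) (filterᵇ (λ j → toℕ i <ᵇ toℕ j) (allFin n))) (allFin n)

numColours : ∀ {n} → Colouring n → ℕ
numColours {n} c = length (deduplicate _≟_ (map (λ e → c (proj₁ e) (proj₂ e)) (edgesK n)))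

P5adj : Fin 5 → Fin 5 → Bool
P5adj a b = suc (toℕ a) Data.Nat.≡ᵇ toℕ b
  where import Data.Nat

houseEdges : List (Fin 5 × Fin 5)
houseEdges = filterᵇ (λ e → not (P5adj (proj₁ e) (proj₂ e))) (edgesK 5)

RainbowHouse : ∀ {n} → Colouring n → Set
RainbowHouse {n} c =
  Σ (Fin 5 → Fin n) λ f →
    Injective _≡_ _≡_ f ×
    Unique (map (λ e → col c (f (proj₁ e)) (f (proj₂ e))) houseEdges)

-- m has the rainbow property for (K_n, H): every colouring of K_n with at
-- least m colours contains a rainbow house.  rb(K_n,H) is the least such m.
RbProperty : ℕ → ℕ → Set
RbProperty n m = (c : Colouring n) → m ≤ numColours c → RainbowHouse c

-- Colour K_{4+i} by giving every edge inside {0,1,2,3} and every edge inside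
-- {4,…,3+i} its own colour and all edges between the two parts one further
-- colour; this uses 7 + C(i,2) colours.  A rainbow house can contain at most
-- one edge between the parts, but the house is 2-edge-connected, so it would
-- have to lie inside one part, and both parts have fewer than five vertices.
module Submission where

open import Defs
open import Data.Nat using (ℕ; suc; _+_; _*_; _∸_; _≤_; _<_; _<ᵇ_; z≤n; s≤s)
open import Data.Nat.Combinatorics using (_C_)
open import Data.Nat.Properties
  using (≤-refl; ≤-trans; +-monoʳ-≤; ≰⇒>; ≮⇒≥; <ᵇ⇒<; <⇒<ᵇ; ∸-monoˡ-<; ∸-cancelʳ-≡; m+n∸m≡n)
open import Data.Fin using (Fin; zero; suc; toℕ; fromℕ<)
open import Data.Fin.Properties using (toℕ<n; toℕ-injective; toℕ-fromℕ<; injective⇒≤)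
open import Data.Bool using (Bool; true; false; T; if_then_else_; _xor_)
import Data.Bool.Properties as Bool
open import Data.Unit using (tt)
open import Data.Empty using (⊥-elim)
open import Data.List using (map)
open import Data.List.Relation.Unary.All using ([]; _∷_)
open import Data.List.Relation.Unary.AllPairs using ([]; _∷_)
open import Data.List.Relation.Unary.Unique.Propositional using (Unique)
open import Data.Product using (_,_; proj₁; proj₂)
open import Function using (_∘_)
open import Function.Definitions using (Injective)
open import Relation.Nullary using (¬_)
open import Relation.Nullary.Decidable using (decidable-stable)
open import Relation.Binary.PropositionalEquality
  using (_≡_; _≢_; refl; sym; trans; cong; subst; module ≡-Reasoning)

injective-into-window⇒≤ : ∀ {m n} {f : Fin m → Fin n} (lo k : ℕ) → Injective _≡_ _≡_ f →
  (∀ v → lo ≤ toℕ (f v)) → (∀ v → toℕ (f v) < lo + k) → m ≤ k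
injective-into-window⇒≤ {m} {f = f} lo k f-inj lo≤f f<lo+k = injective⇒≤ shift-injective
  where
  shift-bound : ∀ v → toℕ (f v) ∸ lo < k
  shift-bound v = subst (toℕ (f v) ∸ lo <_) (m+n∸m≡n lo k) (∸-monoˡ-< (f<lo+k v) (lo≤f v))

  shift : Fin m → Fin k
  shift v = fromℕ< (shift-bound v)

  shift-injective : Injective _≡_ _≡_ shift
  shift-injective {u} {v} eq =
    f-inj (toℕ-injective (∸-cancelʳ-≡ (lo≤f u) (lo≤f v)
      (trans (sym (toℕ-fromℕ< (shift-bound u))) (trans (cong toℕ eq) (toℕ-fromℕ< (shift-bound v))))))

xor-≢ : ∀ {a b : Bool} → a ≢ b → a xor b ≡ true
xor-≢ {false} {false} a≢b = ⊥-elim (a≢b refl)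
xor-≢ {false} {true}  _   = refl
xor-≢ {true}  {false} _   = refl
xor-≢ {true}  {true}  a≢b = ⊥-elim (a≢b refl)

-- The house contains the 5-cycle 0-2-4-1-3-0.  If one of its edges crossed
-- the cut given by s, the distinct weights would force the other four not to,
-- and then their path would put both ends of that edge on the same side.
house-one-sided : (s : Fin 5 → Bool) (w : Fin 5 → Fin 5 → ℕ) →
  (∀ u v → s u ≢ s v → w u v ≡ 0) →
  Unique (map (λ e → w (proj₁ e) (proj₂ e)) houseEdges) →
  ∀ v → s v ≡ s zero
house-one-sided s w crossing⇒0
  ((w02≢w03 ∷ _ ∷ w02≢w13 ∷ w02≢w14 ∷ w02≢w24 ∷ []) ∷
   (_ ∷ w03≢w13 ∷ w03≢w14 ∷ w03≢w24 ∷ []) ∷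
   _ ∷
   (w13≢w14 ∷ w13≢w24 ∷ []) ∷
   (w14≢w24 ∷ []) ∷ _) = one-sided
  where
  open ≡-Reasoning

  0F 1F 2F 3F 4F : Fin 5
  0F = zero
  1F = suc zero
  2F = suc (suc zero)
  3F = suc (suc (suc zero))
  4F = suc (suc (suc (suc zero)))

  not-both-cross : ∀ {a b c d} → w a b ≢ w c d → s a ≢ s b → s c ≡ s d
  not-both-cross {a} {b} {c} {d} wab≢wcd ab-crosses = decidable-stable (s c Bool.≟ s d)
    λ cd-crosses → wab≢wcd (trans (crossing⇒0 a b ab-crosses) (sym (crossing⇒0 c d cd-crosses)))

  uncrossed : ∀ {a b} → (s a ≢ s b → s a ≡ s b) → s a ≡ s b
  uncrossed {a} {b} crossing⇒same = decidable-stable (s a Bool.≟ s b) λ c → c (crossing⇒same c)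

  s0≡s2 : s 0F ≡ s 2F
  s0≡s2 = uncrossed λ c → begin
    s 0F  ≡⟨ not-both-cross w02≢w03 c ⟩
    s 3F  ≡⟨ not-both-cross w02≢w13 c ⟨
    s 1F  ≡⟨ not-both-cross w02≢w14 c ⟩
    s 4F  ≡⟨ not-both-cross w02≢w24 c ⟨
    s 2F  ∎

  s2≡s4 : s 2F ≡ s 4F
  s2≡s4 = uncrossed λ c → begin
    s 2F  ≡⟨ not-both-cross (w02≢w24 ∘ sym) c ⟨
    s 0F  ≡⟨ not-both-cross (w03≢w24 ∘ sym) c ⟩
    s 3F  ≡⟨ not-both-cross (w13≢w24 ∘ sym) c ⟨
    s 1F  ≡⟨ not-both-cross (w14≢w24 ∘ sym) c ⟩
    s 4F  ∎

  s1≡s4 : s 1F ≡ s 4F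
  s1≡s4 = uncrossed λ c → begin
    s 1F  ≡⟨ not-both-cross (w13≢w14 ∘ sym) c ⟩
    s 3F  ≡⟨ not-both-cross (w03≢w14 ∘ sym) c ⟨
    s 0F  ≡⟨ not-both-cross (w02≢w14 ∘ sym) c ⟩
    s 2F  ≡⟨ not-both-cross w14≢w24 c ⟩
    s 4F  ∎

  s1≡s3 : s 1F ≡ s 3F
  s1≡s3 = uncrossed λ c → begin
    s 1F  ≡⟨ not-both-cross w13≢w14 c ⟩
    s 4F  ≡⟨ not-both-cross w13≢w24 c ⟨
    s 2F  ≡⟨ not-both-cross (w02≢w13 ∘ sym) c ⟨
    s 0F  ≡⟨ not-both-cross (w03≢w13 ∘ sym) c ⟩
    s 3F  ∎

  s4≡s0 : s 4F ≡ s 0F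
  s4≡s0 = sym (trans s0≡s2 s2≡s4)

  one-sided : ∀ v → s v ≡ s 0F
  one-sided zero                         = refl
  one-sided (suc zero)                   = trans s1≡s4 s4≡s0
  one-sided (suc (suc zero))             = sym s0≡s2
  one-sided (suc (suc (suc zero)))       = trans (sym s1≡s3) (one-sided 1F)
  one-sided (suc (suc (suc (suc zero)))) = s4≡s0

side : ∀ {n} → ℕ → Fin n → Bool
side k x = toℕ x <ᵇ k

side-true : ∀ {n} k (x : Fin n) → side k x ≡ true → toℕ x < k
side-true k x eq = <ᵇ⇒< (toℕ x) k (subst T (sym eq) tt)

side-false : ∀ {n} k (x : Fin n) → side k x ≡ false → k ≤ toℕ x
side-false k x eq = ≮⇒≥ (λ x<k → subst T eq (<⇒<ᵇ x<k))

-- Inside a part, the nonzero colours suc (a * n + b) of the edges a < b are pairwise distinct.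
splitColouring : (k n : ℕ) → Colouring n
splitColouring k n a b = if side k a xor side k b then 0 else suc (toℕ a * n + toℕ b)

splitColouring-crossing : ∀ k {n} (x y : Fin n) → side k x ≢ side k y →
  col (splitColouring k n) x y ≡ 0
splitColouring-crossing k x y x≁y with toℕ x <ᵇ toℕ y
... | true  rewrite xor-≢ x≁y         = refl
... | false rewrite xor-≢ (x≁y ∘ sym) = refl

five≰four : ¬ 5 ≤ 4
five≰four (s≤s (s≤s (s≤s (s≤s ()))))

splitColouring-houseFree : ∀ {k n} → k ≤ 4 → n ≤ k + 4 → ¬ RainbowHouse (splitColouring k n)
splitColouring-houseFree {k} {n} k≤4 n≤k+4 (f , f-inj , rainbow)
  with side k (f zero) | house-one-sided (side k ∘ f)
         (λ u v → col (splitColouring k n) (f u) (f v))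
         (λ u v → splitColouring-crossing k (f u) (f v)) rainbow
... | true  | one-sided = five≰four (injective-into-window⇒≤ 0 4 f-inj (λ _ → z≤n)
      λ v → ≤-trans (side-true k (f v) (one-sided v)) k≤4)
... | false | one-sided = five≰four (injective-into-window⇒≤ k 4 f-inj
      (λ v → side-false k (f v) (one-sided v))
      λ v → ≤-trans (toℕ<n (f v)) n≤k+4)

houseFree⇒numColours<rb : ∀ {n m} (c : Colouring n) → ¬ RainbowHouse c → RbProperty n m →
  numColours c < m
houseFree⇒numColours<rb c house-free rb = ≰⇒> (λ m≤colours → house-free (rb c m≤colours))

numColours-splitColouring : ∀ {i} → 1 ≤ i → i ≤ 4 → numColours (splitColouring 4 (4 + i)) ≡ 7 + i C 2
numColours-splitColouring {1} _ _ = refl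
numColours-splitColouring {2} _ _ = refl
numColours-splitColouring {3} _ _ = refl
numColours-splitColouring {4} _ _ = refl
numColours-splitColouring {suc (suc (suc (suc (suc _))))} _ (s≤s (s≤s (s≤s (s≤s ()))))

lemma7 : (i : ℕ) → 1 ≤ i → i ≤ 4 →
    (m : ℕ) → RbProperty (4 + i) m → 8 + (i C 2) ≤ m
lemma7 i 1≤i i≤4 m rb =
  subst (_< m) (numColours-splitColouring 1≤i i≤4)
    (houseFree⇒numColours<rb (splitColouring 4 (4 + i))
      (splitColouring-houseFree ≤-refl (+-monoʳ-≤ 4 i≤4)) rb)
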